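{- Let $p\ge 1$ and let $T$ be a CNAT of size $2p$ all of whose leaves are short. Then $\operatorname{sgn}\pi(T)=(-1)^p$.
   Context: A non-ambiguous tree (NAT) is a filling of a rectangular grid in which each cell is dotted or not, such that: the top-left cell is dotted (the root); every dotted cell other than the root has either a dotted cell above it in the same column or a dotted cell to its left in the same row, but not both; and every row and every column contains at least one dotted cell. Each non-root dot has a parent: the nearest dot above it in its column, or the nearest dot to its left in its row. A complete non-ambiguous tree (CNAT) is a NAT in which every dot either has both a dot below it in its column and a dot to its right in its row (an internal dot), or neither (a leaf). The size $n$ of a CNAT is its number of leaves; a CNAT of size $n$ has $n$ rows and $n$ columns, labelled $1,\dots,n$ from top to bottom and from left to right, and each row and each column contains exactly one leaf. The associated permutation $\pi(T)$ is the permutation of $\{1,\dots,n\}$ whose graph is the set of leaf positions: $\pi(T)(i)=j$ iff the leaf in column $i$ lies in row $j$. A leaf is short if its parent lies in a cell adjacent to it, and long otherwise. -}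

module Defs where

open import Data.Nat as ℕ using (ℕ; zero; suc)
open import Data.Fin as Fin using (Fin; toℕ)
open import Data.Fin.Properties using (_<?_)
open import Data.Bool using (Bool; true)
open import Data.Product using (Σ; ∃; _×_; _,_)
open import Data.Sum using (_⊎_)
open import Data.List using (List; length; filter; allFin; concatMap; map)
open import Data.Sign using (Sign; +; -)
open import Data.Fin.Permutation using (Permutation′; _⟨$⟩ʳ_)
open import Relation.Nullary using (¬_)
open import Relation.Binary.PropositionalEquality using (_≡_)

-- A filling of an n × n grid: g r c = true iff the cell in row r, column c
-- is dotted (rows from top, columns from left, both 0-indexed here).
Grid : ℕ → Set
Grid n = Fin n → Fin n → Bool

module _ {n : ℕ} (g : Grid n) where

  Dot : Fin n → Fin n → Set
  Dot r c = g r c ≡ true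

  DotAbove : Fin n → Fin n → Set
  DotAbove r c = Σ (Fin n) λ r′ → r′ Fin.< r × Dot r′ c

  DotLeft : Fin n → Fin n → Set
  DotLeft r c = Σ (Fin n) λ c′ → c′ Fin.< c × Dot r c′

  DotBelow : Fin n → Fin n → Set
  DotBelow r c = Σ (Fin n) λ r′ → r Fin.< r′ × Dot r′ c

  DotRight : Fin n → Fin n → Set
  DotRight r c = Σ (Fin n) λ c′ → c Fin.< c′ × Dot r c′

  IsRoot : Fin n → Fin n → Set
  IsRoot r c = toℕ r ≡ 0 × toℕ c ≡ 0

  record IsNAT : Set where
    field
      root-dotted : ∀ r c → IsRoot r c → Dot r c
      non-root    : ∀ r c → Dot r c → ¬ IsRoot r c →
                    (DotAbove r c ⊎ DotLeft r c) × ¬ (DotAbove r c × DotLeft r c)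
      row-nonempty : ∀ r → Σ (Fin n) λ c → Dot r c
      col-nonempty : ∀ c → Σ (Fin n) λ r → Dot r c

  IsLeaf : Fin n → Fin n → Set
  IsLeaf r c = Dot r c × ¬ DotBelow r c × ¬ DotRight r c

  record IsCNAT : Set where
    field
      nat      : IsNAT
      complete : ∀ r c → Dot r c →
                 (DotBelow r c × DotRight r c) ⊎ (¬ DotBelow r c × ¬ DotRight r c)

  IsParent : Fin n → Fin n → Fin n → Fin n → Set
  IsParent r′ c′ r c =
      (c′ ≡ c × r′ Fin.< r × Dot r′ c ×
        (∀ r″ → r′ Fin.< r″ → r″ Fin.< r → ¬ Dot r″ c))
    ⊎ (r′ ≡ r × c′ Fin.< c × Dot r c′ ×
        (∀ c″ → c′ Fin.< c″ → c″ Fin.< c → ¬ Dot r c″))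

  Adjacent : Fin n → Fin n → Fin n → Fin n → Set
  Adjacent r′ c′ r c =
      (r′ ≡ r × (suc (toℕ c′) ≡ toℕ c ⊎ suc (toℕ c) ≡ toℕ c′))
    ⊎ (c′ ≡ c × (suc (toℕ r′) ≡ toℕ r ⊎ suc (toℕ r) ≡ toℕ r′))

  ShortLeaf : Fin n → Fin n → Set
  ShortLeaf r c = IsLeaf r c ×
    Σ (Fin n) λ r′ → Σ (Fin n) λ c′ → IsParent r′ c′ r c × Adjacent r′ c′ r c

  AllLeavesShort : Set
  AllLeavesShort = ∀ r c → IsLeaf r c → ShortLeaf r c

-- σ is the associated permutation π(T): σ(i) = j iff the leaf in column i
-- lies in row j, i.e. the graph of σ is exactly the set of leaf positions.
IsLeafPermutation : ∀ {n} → Grid n → Permutation′ n → Set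
IsLeafPermutation {n} g σ =
  ∀ (i j : Fin n) → (σ ⟨$⟩ʳ i ≡ j → IsLeaf g j i) × (IsLeaf g j i → σ ⟨$⟩ʳ i ≡ j)

inversions : ∀ {n} → Permutation′ n → ℕ
inversions {n} σ =
  length (filter (λ ij → (σ ⟨$⟩ʳ Data.Product.proj₂ ij) <? (σ ⟨$⟩ʳ Data.Product.proj₁ ij))
    (filter (λ ij → Data.Product.proj₁ ij <? Data.Product.proj₂ ij)
      (concatMap (λ i → map (λ j → (i , j)) (allFin n)) (allFin n))))
  where import Data.Product

neg1^ : ℕ → Sign
neg1^ zero = +
neg1^ (suc k) = Data.Sign._*_ - (neg1^ k)
  where import Data.Sign

sgn : ∀ {n} → Permutation′ n → Sign
sgn σ = neg1^ (inversions σ)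

-- Let the leaf of column c lie in row π c.  A short leaf lies either just
-- below or just to the right of its parent.  If the leaf of column c lies
-- just below its parent, the leaf e of the parent's row π c − 1 is to the
-- right of c (else it would not be a leaf) and lies just to the right of its
-- parent (else it would have dots both above it and to its left).  Sending
-- c to e − 1 is a non-decreasing injection on such columns, hence the
-- identity, so e = c + 1.  Starting from column 0, this pairs the columns as
-- {2k, 2k + 1} with π (2k) = π (2k + 1) + 1.  Such a permutation has one
-- inversion inside each pair and, between two pairs, four inversions or none.

module Submission where

open import Defs
open import Data.Nat using (ℕ; zero; suc; _+_; _*_; _≤_; _<_; s≤s; z<s; s<s; s≤s⁻¹; s<s⁻¹)
open import Data.Nat.Properties using (_<?_; _≟_; <-cmp; ≤-refl; ≤-trans; ≤-reflexive; <-trans; <⇒≤; <⇒≢; ≤⇒≯; ≤∧≢⇒<; n≤1+n; n<1+n; m<n⇒m<1+n; +-suc; +-assoc; +-identityʳ; +-mono-≤; *-distribˡ-+; *-zeroʳ; suc-injective; +-commutativeSemigroup)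
open import Algebra.Properties.CommutativeSemigroup +-commutativeSemigroup using (interchange)
open import Data.Fin as Fin using (Fin; toℕ; fromℕ<)
open import Data.Fin.Properties using (toℕ-injective; toℕ-fromℕ<; fromℕ<-toℕ; toℕ<n)
import Data.Fin.Properties as Finₚ
open import Data.Fin.Induction using (>-wellFounded)
open import Data.Fin.Permutation using (Permutation′; _⟨$⟩ʳ_; _⟨$⟩ˡ_; inverseˡ; inverseʳ)
open import Data.List using (List; []; _∷_; _++_; length; filter; map; concatMap; allFin; tabulate)
open import Data.List.Properties using (map-∘; map-++; map-tabulate)
open import Data.Nat.ListAction using (sum)
open import Data.Nat.ListAction.Properties using (sum-++)
open import Data.Product using (Σ; _×_; _,_; proj₁; proj₂)
open import Data.Sum using (_⊎_; inj₁; inj₂)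
open import Data.Sign.Properties using (opposite-involutive)
open import Data.Empty using (⊥; ⊥-elim)
open import Function using (_∘_; id)
open import Induction.WellFounded using (Acc; acc)
open import Relation.Nullary using (¬_; Dec; yes; no; contradiction)
open import Relation.Unary using (Decidable)
open import Relation.Binary using (tri<; tri≈; tri>)
open import Relation.Binary.PropositionalEquality using (_≡_; _≢_; refl; sym; trans; cong; cong₂; subst; module ≡-Reasoning)
open ≡-Reasoning

χ : {A : Set} → Dec A → ℕ
χ (yes _) = 1
χ (no _)  = 0

χ-yes : {A : Set} (d : Dec A) → A → χ d ≡ 1
χ-yes (yes _) _ = refl
χ-yes (no ¬a) a = contradiction a ¬a

χ-no : {A : Set} (d : Dec A) → ¬ A → χ d ≡ 0
χ-no (yes a) ¬a = contradiction a ¬a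
χ-no (no _)  _  = refl

χ-≟-suc : ∀ k l → χ (suc k ≟ suc l) ≡ χ (k ≟ l)
χ-≟-suc k l with k ≟ l
... | yes k≡l = χ-yes (suc k ≟ suc l) (cong suc k≡l)
... | no  k≢l = χ-no (suc k ≟ suc l) (k≢l ∘ suc-injective)

∑< : ℕ → (ℕ → ℕ) → ℕ
∑< zero    f = 0
∑< (suc m) f = f 0 + ∑< m (f ∘ suc)

∑<-cong : ∀ m {f g : ℕ → ℕ} → (∀ i → i < m → f i ≡ g i) → ∑< m f ≡ ∑< m g
∑<-cong zero    _   = refl
∑<-cong (suc m) f≡g = cong₂ _+_ (f≡g 0 z<s) (∑<-cong m (λ i i<m → f≡g (suc i) (s<s i<m)))

∑<-zero : ∀ m {f : ℕ → ℕ} → (∀ i → i < m → f i ≡ 0) → ∑< m f ≡ 0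
∑<-zero zero    _   = refl
∑<-zero (suc m) f≡0 = cong₂ _+_ (f≡0 0 z<s) (∑<-zero m (λ i i<m → f≡0 (suc i) (s<s i<m)))

∑<-one : ∀ m → ∑< m (λ _ → 1) ≡ m
∑<-one zero    = refl
∑<-one (suc m) = cong suc (∑<-one m)

∑<-+ : ∀ m (f g : ℕ → ℕ) → ∑< m (λ i → f i + g i) ≡ ∑< m f + ∑< m g
∑<-+ zero    f g = refl
∑<-+ (suc m) f g = trans (cong (f 0 + g 0 +_) (∑<-+ m (f ∘ suc) (g ∘ suc)))
                         (interchange (f 0) (g 0) (∑< m (f ∘ suc)) (∑< m (g ∘ suc)))

∑<-* : ∀ m k (f : ℕ → ℕ) → ∑< m (λ i → k * f i) ≡ k * ∑< m f
∑<-* zero    k f = sym (*-zeroʳ k)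
∑<-* (suc m) k f = trans (cong (k * f 0 +_) (∑<-* m k (f ∘ suc)))
                         (sym (*-distribˡ-+ k (f 0) (∑< m (f ∘ suc))))

∑<-pairs : ∀ p (f : ℕ → ℕ) → ∑< (p + p) f ≡ ∑< p (λ k → f (k + k) + f (suc (k + k)))
∑<-pairs zero    f = refl
∑<-pairs (suc p) f rewrite +-suc p p = begin
    f 0 + (f 1 + ∑< (p + p) (f ∘ suc ∘ suc))
  ≡˘⟨ +-assoc (f 0) (f 1) _ ⟩
    f 0 + f 1 + ∑< (p + p) (f ∘ suc ∘ suc)
  ≡⟨ cong (f 0 + f 1 +_) (∑<-pairs p (f ∘ suc ∘ suc)) ⟩
    f 0 + f 1 + ∑< p (λ k → f (suc (suc (k + k))) + f (suc (suc (suc (k + k)))))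
  ≡˘⟨ cong (f 0 + f 1 +_) (∑<-cong p (λ k _ → cong (λ i → f i + f (suc i)) (cong suc (+-suc k k)))) ⟩
    f 0 + f 1 + ∑< p (λ k → f (suc k + suc k) + f (suc (suc k + suc k))) ∎

∑<-χ≟ : ∀ {k m} → k < m → ∑< m (λ l → χ (k ≟ l)) ≡ 1
∑<-χ≟ {zero}  {suc m} _   = cong₂ _+_ (χ-yes (0 ≟ 0) refl) (∑<-zero m (λ l _ → χ-no (0 ≟ suc l) λ ()))
∑<-χ≟ {suc k} {suc m} k<m = cong₂ _+_ (χ-no (suc k ≟ 0) λ ())
  (trans (∑<-cong m (λ l _ → χ-≟-suc k l)) (∑<-χ≟ (s<s⁻¹ k<m)))

1+m≡n⇒n≮m : ∀ {m n} → suc m ≡ n → ¬ n < m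
1+m≡n⇒n≮m refl = ≤⇒≯ (n≤1+n _)

1+k+k<l+l : ∀ {k l} → k < l → suc (k + k) < l + l
1+k+k<l+l {k} {l} k<l = subst (_≤ l + l) (cong suc (+-suc k k)) (+-mono-≤ k<l k<l)

k+k<l+l : ∀ {k l} → k < l → k + k < l + l
k+k<l+l k<l = <-trans (n<1+n _) (1+k+k<l+l k<l)

inversion : (ℕ → ℕ) → ℕ → ℕ → ℕ
inversion s a b = χ (a <? b) * χ (s b <? s a)

inversionCount : ℕ → (ℕ → ℕ) → ℕ
inversionCount n s = ∑< n (λ a → ∑< n (inversion s a))

inversion-< : ∀ s {a b} → a < b → inversion s a b ≡ χ (s b <? s a)
inversion-< s {a} {b} a<b =
  trans (cong (_* χ (s b <? s a)) (χ-yes (a <? b) a<b)) (+-identityʳ _)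

inversion-≥ : ∀ s {a b} → b ≤ a → inversion s a b ≡ 0
inversion-≥ s {a} {b} b≤a = cong (_* χ (s b <? s a)) (χ-no (a <? b) (≤⇒≯ b≤a))

descendingPairs-inversions : ∀ x y → x ≢ y → x ≢ suc y →
  (χ (suc y <? suc x) + χ (y <? suc x)) + (χ (suc y <? x) + χ (y <? x)) ≡ 4 * χ (y <? x)
descendingPairs-inversions x y x≢y x≢1+y with <-cmp y x
... | tri< y<x _ _
  rewrite χ-yes (suc y <? suc x) (s<s y<x) | χ-yes (y <? suc x) (m<n⇒m<1+n y<x)
        | χ-yes (suc y <? x) (≤∧≢⇒< y<x (x≢1+y ∘ sym)) | χ-yes (y <? x) y<x = refl
... | tri≈ _ y≡x _ = contradiction (sym y≡x) x≢y
... | tri> _ _ x<y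
  rewrite χ-no (suc y <? suc x) (≤⇒≯ (s≤s (<⇒≤ x<y))) | χ-no (y <? suc x) (≤⇒≯ x<y)
        | χ-no (suc y <? x) (≤⇒≯ (≤-trans (<⇒≤ x<y) (n≤1+n y))) | χ-no (y <? x) (≤⇒≯ (<⇒≤ x<y)) = refl

module PairedInversions (p : ℕ) (s : ℕ → ℕ)
  (s-injective : ∀ {a b} → a < p + p → b < p + p → s a ≡ s b → a ≡ b)
  (s-paired : ∀ k → k < p → s (k + k) ≡ suc (s (suc (k + k)))) where

  block : ℕ → ℕ → ℕ
  block k l = (inversion s (k + k) (l + l) + inversion s (k + k) (suc (l + l)))
            + (inversion s (suc (k + k)) (l + l) + inversion s (suc (k + k)) (suc (l + l)))

  oddInversion : ℕ → ℕ → ℕ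
  oddInversion k l = inversion s (suc (k + k)) (suc (l + l))

  block-< : ∀ {k l} → k < l → k < p → l < p → block k l ≡ 4 * oddInversion k l
  block-< {k} {l} k<l k<p l<p = begin
      block k l
    ≡⟨ cong₂ _+_ (cong₂ _+_ (inversion-< s (k+k<l+l k<l)) (inversion-< s (m<n⇒m<1+n (k+k<l+l k<l))))
                 (cong₂ _+_ (inversion-< s odd<even) (inversion-< s odd<odd)) ⟩
      (χ (s (l + l) <? s (k + k)) + χ (y <? s (k + k))) + (χ (s (l + l) <? x) + χ (y <? x))
    ≡⟨ cong₂ (λ u v → (χ (v <? u) + χ (y <? u)) + (χ (v <? x) + χ (y <? x))) (s-paired k k<p) (s-paired l l<p) ⟩
      (χ (suc y <? suc x) + χ (y <? suc x)) + (χ (suc y <? x) + χ (y <? x))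
    ≡⟨ descendingPairs-inversions x y x≢y x≢1+y ⟩
      4 * χ (y <? x)
    ≡⟨ cong (4 *_) (sym (inversion-< s odd<odd)) ⟩
      4 * oddInversion k l ∎
    where
      x y : ℕ
      x = s (suc (k + k))
      y = s (suc (l + l))
      odd<even : suc (k + k) < l + l
      odd<even = 1+k+k<l+l k<l
      odd<odd : suc (k + k) < suc (l + l)
      odd<odd = m<n⇒m<1+n odd<even
      x≢y : x ≢ y
      x≢y x≡y = <⇒≢ odd<odd (s-injective (1+k+k<l+l k<p) (1+k+k<l+l l<p) x≡y)
      x≢1+y : x ≢ suc y
      x≢1+y x≡1+y = <⇒≢ odd<even
        (s-injective (1+k+k<l+l k<p) (k+k<l+l l<p) (trans x≡1+y (sym (s-paired l l<p))))

  block-≡ : ∀ {k} → k < p → block k k ≡ 1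
  block-≡ {k} k<p = begin
      block k k
    ≡⟨ cong₂ _+_ (cong₂ _+_ (inversion-≥ s {k + k} ≤-refl) (inversion-< s (n<1+n (k + k))))
                 (cong₂ _+_ (inversion-≥ s (n≤1+n (k + k))) (inversion-≥ s {suc (k + k)} ≤-refl)) ⟩
      (0 + χ (x <? s (k + k))) + (0 + 0)
    ≡⟨ cong (λ u → χ (x <? u) + 0) (s-paired k k<p) ⟩
      χ (x <? suc x) + 0
    ≡⟨ cong (_+ 0) (χ-yes (x <? suc x) (n<1+n x)) ⟩
      1 ∎
    where
      x : ℕ
      x = s (suc (k + k))

  block-> : ∀ {k l} → l < k → block k l ≡ 0
  block-> {k} {l} l<k =
    cong₂ _+_ (cong₂ _+_ (inversion-≥ s {k + k} {l + l} even≤even)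
                         (inversion-≥ s {k + k} {suc (l + l)} (<⇒≤ (1+k+k<l+l l<k))))
              (cong₂ _+_ (inversion-≥ s {suc (k + k)} {l + l} (≤-trans even≤even (n≤1+n _)))
                         (inversion-≥ s {suc (k + k)} {suc (l + l)} (s≤s even≤even)))
    where
      even≤even : l + l ≤ k + k
      even≤even = <⇒≤ (k+k<l+l l<k)

  block≡ : ∀ {k l} → k < p → l < p → block k l ≡ 4 * oddInversion k l + χ (k ≟ l)
  block≡ {k} {l} k<p l<p with <-cmp k l
  ... | tri< k<l k≢l _ = trans (block-< k<l k<p l<p)
    (sym (trans (cong (4 * oddInversion k l +_) (χ-no (k ≟ l) k≢l)) (+-identityʳ _)))
  ... | tri≈ _ refl _ = trans (block-≡ k<p)
    (sym (cong₂ _+_ (cong (4 *_) (inversion-≥ s {suc (k + k)} ≤-refl)) (χ-yes (k ≟ k) refl)))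
  ... | tri> _ k≢l l<k = trans (block-> l<k)
    (sym (cong₂ _+_ (cong (4 *_) (inversion-≥ s {suc (k + k)} {suc (l + l)} (s≤s (<⇒≤ (k+k<l+l l<k)))))
                    (χ-no (k ≟ l) k≢l)))

  pairOfRows : ∀ {k} → k < p →
    ∑< (p + p) (inversion s (k + k)) + ∑< (p + p) (inversion s (suc (k + k))) ≡ 4 * ∑< p (oddInversion k) + 1
  pairOfRows {k} k<p = begin
      ∑< (p + p) (inversion s (k + k)) + ∑< (p + p) (inversion s (suc (k + k)))
    ≡⟨ cong₂ _+_ (∑<-pairs p _) (∑<-pairs p _) ⟩
      ∑< p (λ l → inversion s (k + k) (l + l) + inversion s (k + k) (suc (l + l)))
        + ∑< p (λ l → inversion s (suc (k + k)) (l + l) + inversion s (suc (k + k)) (suc (l + l)))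
    ≡˘⟨ ∑<-+ p _ _ ⟩
      ∑< p (block k)
    ≡⟨ ∑<-cong p (λ l l<p → block≡ k<p l<p) ⟩
      ∑< p (λ l → 4 * oddInversion k l + χ (k ≟ l))
    ≡⟨ ∑<-+ p _ _ ⟩
      ∑< p (λ l → 4 * oddInversion k l) + ∑< p (λ l → χ (k ≟ l))
    ≡⟨ cong₂ _+_ (∑<-* p 4 (oddInversion k)) (∑<-χ≟ k<p) ⟩
      4 * ∑< p (oddInversion k) + 1 ∎

  inversionCount-paired : inversionCount (p + p) s ≡ 4 * ∑< p (λ k → ∑< p (oddInversion k)) + p
  inversionCount-paired = begin
      inversionCount (p + p) s
    ≡⟨ ∑<-pairs p _ ⟩
      ∑< p (λ k → ∑< (p + p) (inversion s (k + k)) + ∑< (p + p) (inversion s (suc (k + k))))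
    ≡⟨ ∑<-cong p (λ _ → pairOfRows) ⟩
      ∑< p (λ k → 4 * ∑< p (oddInversion k) + 1)
    ≡⟨ ∑<-+ p _ _ ⟩
      ∑< p (λ k → 4 * ∑< p (oddInversion k)) + ∑< p (λ _ → 1)
    ≡⟨ cong₂ _+_ (∑<-* p 4 _) (∑<-one p) ⟩
      4 * ∑< p (λ k → ∑< p (oddInversion k)) + p ∎

⟨$⟩ʳ-injective : ∀ {n} (σ : Permutation′ n) {i j} → σ ⟨$⟩ʳ i ≡ σ ⟨$⟩ʳ j → i ≡ j
⟨$⟩ʳ-injective σ σi≡σj = trans (sym (inverseˡ σ)) (trans (cong (σ ⟨$⟩ˡ_) σi≡σj) (inverseˡ σ))

onℕ : ∀ {n} → (Fin n → Fin n) → ℕ → ℕ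
onℕ {n} f m with m <? n
... | yes m<n = toℕ (f (fromℕ< m<n))
... | no  _   = 0

onℕ-toℕ : ∀ {n} (f : Fin n → Fin n) (i : Fin n) → onℕ f (toℕ i) ≡ toℕ (f i)
onℕ-toℕ {n} f i with toℕ i <? n
... | yes i<n = cong (toℕ ∘ f) (fromℕ<-toℕ i i<n)
... | no  i≮n = contradiction (toℕ<n i) i≮n

onℕ-injective : ∀ {n} (f : Fin n → Fin n) → (∀ {i j} → f i ≡ f j → i ≡ j) →
  ∀ {a b} → a < n → b < n → onℕ f a ≡ onℕ f b → a ≡ b
onℕ-injective f f-injective {a} {b} a<n b<n fa≡fb = begin
    a                   ≡˘⟨ toℕ-fromℕ< a<n ⟩
    toℕ (fromℕ< a<n)    ≡⟨ cong toℕ (f-injective (toℕ-injective f[a]≡f[b])) ⟩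
    toℕ (fromℕ< b<n)    ≡⟨ toℕ-fromℕ< b<n ⟩
    b                   ∎
  where
    onℕ-fromℕ< : ∀ {m} (m<n : m < _) → onℕ f m ≡ toℕ (f (fromℕ< m<n))
    onℕ-fromℕ< m<n = trans (cong (onℕ f) (sym (toℕ-fromℕ< m<n))) (onℕ-toℕ f (fromℕ< m<n))
    f[a]≡f[b] : toℕ (f (fromℕ< a<n)) ≡ toℕ (f (fromℕ< b<n))
    f[a]≡f[b] = trans (sym (onℕ-fromℕ< a<n)) (trans fa≡fb (onℕ-fromℕ< b<n))

length-filter-filter : {A : Set} {P Q : A → Set} (P? : Decidable P) (Q? : Decidable Q) (xs : List A) →
  length (filter Q? (filter P? xs)) ≡ sum (map (λ x → χ (P? x) * χ (Q? x)) xs)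
length-filter-filter P? Q? []       = refl
length-filter-filter P? Q? (x ∷ xs) with P? x
... | no  _ = length-filter-filter P? Q? xs
... | yes _ with Q? x
...   | yes _ = cong suc (length-filter-filter P? Q? xs)
...   | no  _ = length-filter-filter P? Q? xs

sum-map-concatMap : {A B : Set} (w : B → ℕ) (F : A → List B) (xs : List A) →
  sum (map w (concatMap F xs)) ≡ sum (map (λ x → sum (map w (F x))) xs)
sum-map-concatMap w F []       = refl
sum-map-concatMap w F (x ∷ xs) = begin
    sum (map w (F x ++ concatMap F xs))
  ≡⟨ cong sum (map-++ w (F x) _) ⟩
    sum (map w (F x) ++ map w (concatMap F xs))
  ≡⟨ sum-++ (map w (F x)) _ ⟩
    sum (map w (F x)) + sum (map w (concatMap F xs))
  ≡⟨ cong (sum (map w (F x)) +_) (sum-map-concatMap w F xs) ⟩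
    sum (map w (F x)) + sum (map (λ x → sum (map w (F x))) xs) ∎

sum-tabulate : ∀ n (f : Fin n → ℕ) (F : ℕ → ℕ) → (∀ i → f i ≡ F (toℕ i)) → sum (tabulate f) ≡ ∑< n F
sum-tabulate zero    f F f≡F = refl
sum-tabulate (suc n) f F f≡F =
  cong₂ _+_ (f≡F Fin.zero) (sum-tabulate n (f ∘ Fin.suc) (F ∘ suc) (f≡F ∘ Fin.suc))

sum-map-allFin : ∀ {n} (f : Fin n → ℕ) (F : ℕ → ℕ) → (∀ i → f i ≡ F (toℕ i)) → sum (map f (allFin n)) ≡ ∑< n F
sum-map-allFin {n} f F f≡F = trans (cong sum (map-tabulate id f)) (sum-tabulate n f F f≡F)

inversions≡inversionCount : ∀ {n} (σ : Permutation′ n) → inversions σ ≡ inversionCount n (onℕ (σ ⟨$⟩ʳ_))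
inversions≡inversionCount {n} σ = begin
    inversions σ
  ≡⟨ length-filter-filter _ _ pairs ⟩
    sum (map w pairs)
  ≡⟨ sum-map-concatMap w row (allFin n) ⟩
    sum (map (λ i → sum (map w (row i))) (allFin n))
  ≡⟨ sum-map-allFin _ _ (λ i → trans (cong sum (sym (map-∘ (allFin n)))) (sum-map-allFin _ _ (w≡inversion i))) ⟩
    inversionCount n s ∎
  where
    s : ℕ → ℕ
    s = onℕ (σ ⟨$⟩ʳ_)
    row : Fin n → List (Fin n × Fin n)
    row i = map (i ,_) (allFin n)
    pairs : List (Fin n × Fin n)
    pairs = concatMap row (allFin n)
    w : Fin n × Fin n → ℕ
    w ij = χ (proj₁ ij Finₚ.<? proj₂ ij) * χ ((σ ⟨$⟩ʳ proj₂ ij) Finₚ.<? (σ ⟨$⟩ʳ proj₁ ij))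
    w≡inversion : ∀ i j → w (i , j) ≡ inversion s (toℕ i) (toℕ j)
    w≡inversion i j = cong₂ (λ u v → χ (toℕ i <? toℕ j) * χ (u <? v)) (sym (onℕ-toℕ _ j)) (sym (onℕ-toℕ _ i))

neg1^-4*+ : ∀ m q → neg1^ (4 * m + q) ≡ neg1^ q
neg1^-4*+ zero    q = refl
neg1^-4*+ (suc m) q = begin
    neg1^ (4 * suc m + q)                ≡⟨ cong (λ t → neg1^ (t + q)) (*-distribˡ-+ 4 1 m) ⟩
    neg1^ (4 + (4 * m + q))              ≡⟨ opposite-involutive _ ⟩
    neg1^ (2 + (4 * m + q))              ≡⟨ opposite-involutive _ ⟩
    neg1^ (4 * m + q)                    ≡⟨ neg1^-4*+ m q ⟩
    neg1^ q                              ∎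

sgn-paired : ∀ {n} p → n ≡ p + p → (σ : Permutation′ n) →
  (∀ k → k + k < n → onℕ (σ ⟨$⟩ʳ_) (k + k) ≡ suc (onℕ (σ ⟨$⟩ʳ_) (suc (k + k)))) →
  sgn σ ≡ neg1^ p
sgn-paired p refl σ paired = begin
    sgn σ
  ≡⟨ cong neg1^ (inversions≡inversionCount σ) ⟩
    neg1^ (inversionCount (p + p) s)
  ≡⟨ cong neg1^ inversionCount-paired ⟩
    neg1^ (4 * ∑< p (λ k → ∑< p (oddInversion k)) + p)
  ≡⟨ neg1^-4*+ (∑< p (λ k → ∑< p (oddInversion k))) p ⟩
    neg1^ p ∎
  where
    s : ℕ → ℕ
    s = onℕ (σ ⟨$⟩ʳ_)
    s-injective : ∀ {a b} → a < p + p → b < p + p → s a ≡ s b → a ≡ b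
    s-injective = onℕ-injective (σ ⟨$⟩ʳ_) (⟨$⟩ʳ-injective σ)
    open PairedInversions p s s-injective (λ k k<p → paired k (k+k<l+l k<p))

inflationary-injection-fixes : ∀ {n} {P : Fin n → Set} (f : ∀ {i} → P i → Σ (Fin n) P) →
  (∀ {i} (x : P i) → i Fin.≤ proj₁ (f x)) →
  (∀ {i j} (x : P i) (y : P j) → proj₁ (f x) ≡ proj₁ (f y) → i ≡ j) →
  ∀ {i} (x : P i) → proj₁ (f x) ≡ i
inflationary-injection-fixes {P = P} f inflationary injective x = fixes (>-wellFounded _) x
  where
    fixes : ∀ {i} → Acc Fin._>_ i → (x : P i) → proj₁ (f x) ≡ i
    fixes {i} (acc rs) x with proj₁ (f x) Finₚ.≟ i
    ... | yes fx≡i = fx≡i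
    ... | no  fx≢i = contradiction (injective (proj₂ (f x)) x (fixes (rs i<fx) (proj₂ (f x)))) fx≢i
      where
        i<fx : i Fin.< proj₁ (f x)
        i<fx = Finₚ.≤∧≢⇒< (inflationary x) (fx≢i ∘ sym)

module ShortLeaves {n : ℕ} (g : Grid n) (nat : IsNAT g) (short : AllLeavesShort g)
                   (σ : Permutation′ n) (leaves : IsLeafPermutation g σ) where

  π : Fin n → Fin n
  π = σ ⟨$⟩ʳ_

  leaf : ∀ c → IsLeaf g (π c) c
  leaf c = proj₁ (leaves c (π c)) refl

  ¬above×left : ∀ {r c} → Dot g r c → DotAbove g r c → DotLeft g r c → ⊥
  ¬above×left {r} {c} dot above@(_ , r′<r , _) left =
    proj₂ (IsNAT.non-root nat r c dot not-root) (above , left)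
    where
      not-root : ¬ IsRoot g r c
      not-root (r≡0 , _) with subst (toℕ (proj₁ above) <_) r≡0 r′<r
      ... | ()

  ParentAbove : Fin n → Set
  ParentAbove c = Σ (Fin n) λ r → suc (toℕ r) ≡ toℕ (π c) × Dot g r c

  ParentLeft : Fin n → Set
  ParentLeft c = Σ (Fin n) λ c′ → suc (toℕ c′) ≡ toℕ c × Dot g (π c) c′

  parentAbove⊎parentLeft : ∀ c → ParentAbove c ⊎ ParentLeft c
  parentAbove⊎parentLeft c with short (π c) c (leaf c)
  ... | _ , r , _ , inj₁ (_ , r<π , _ , _)   , inj₁ (r≡π , _)         = contradiction (cong toℕ r≡π) (<⇒≢ r<π)
  ... | _ , r , _ , inj₁ (_ , _ , dot , _)   , inj₂ (_ , inj₁ 1+r≡π)  = inj₁ (r , 1+r≡π , dot)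
  ... | _ , r , _ , inj₁ (_ , r<π , _ , _)   , inj₂ (_ , inj₂ 1+π≡r)  = contradiction r<π (1+m≡n⇒n≮m 1+π≡r)
  ... | _ , _ , c′ , inj₂ (_ , _ , dot , _)  , inj₁ (_ , inj₁ 1+c′≡c) = inj₂ (c′ , 1+c′≡c , dot)
  ... | _ , _ , c′ , inj₂ (_ , c′<c , _ , _) , inj₁ (_ , inj₂ 1+c≡c′) = contradiction c′<c (1+m≡n⇒n≮m 1+c≡c′)
  ... | _ , _ , c′ , inj₂ (_ , c′<c , _ , _) , inj₂ (c′≡c , _)        = contradiction (cong toℕ c′≡c) (<⇒≢ c′<c)

  ¬parentAbove×parentLeft : ∀ {c} → ParentAbove c → ParentLeft c → ⊥
  ¬parentAbove×parentLeft {c} (r , 1+r≡π , dot) (c′ , 1+c′≡c , dot′) =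
    ¬above×left (proj₁ (leaf c)) (r , ≤-reflexive 1+r≡π , dot) (c′ , ≤-reflexive 1+c′≡c , dot′)

  parentLeft⇒parentAbove : ∀ {c} (h : ParentLeft c) → ParentAbove (proj₁ h)
  parentLeft⇒parentAbove {c} (c′ , 1+c′≡c , dot) with parentAbove⊎parentLeft c′
  ... | inj₁ above = above
  ... | inj₂ (c″ , 1+c″≡c′ , dot″) with Finₚ.<-cmp (π c) (π c′)
  ...   | tri< πc<πc′ _ _ =
    ⊥-elim (¬above×left (proj₁ (leaf c′)) (π c , πc<πc′ , dot) (c″ , ≤-reflexive 1+c″≡c′ , dot″))
  ...   | tri≈ _ πc≡πc′ _ = contradiction (trans 1+c′≡c (cong toℕ (⟨$⟩ʳ-injective σ πc≡πc′))) (<⇒≢ (n<1+n _) ∘ sym)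
  ...   | tri> _ _ πc′<πc = ⊥-elim (proj₁ (proj₂ (leaf c′)) (π c , πc′<πc , dot))

  record Partner (c : Fin n) : Set where
    field
      column   : Fin n
      right    : c Fin.< column
      rowAbove : suc (toℕ (π column)) ≡ toℕ (π c)
      left     : ParentLeft column

    before : Fin n
    before = proj₁ left

    1+before≡column : suc (toℕ before) ≡ toℕ column
    1+before≡column = proj₁ (proj₂ left)

  partner : ∀ {c} → ParentAbove c → Partner c
  partner {c} (r , 1+r≡πc , dot) = record
    { column = e ; right = c<e ; rowAbove = trans (cong (suc ∘ toℕ) πe≡r) 1+r≡πc ; left = left }
    where
      e : Fin n
      e = σ ⟨$⟩ˡ r
      πe≡r : π e ≡ r
      πe≡r = inverseʳ σ
      leafₑ : IsLeaf g r e
      leafₑ = subst (λ r′ → IsLeaf g r′ e) πe≡r (leaf e)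
      c<e : c Fin.< e
      c<e with Finₚ.<-cmp c e
      ... | tri< c<e _ _ = c<e
      ... | tri≈ _ c≡e _ =
        ⊥-elim (proj₁ (proj₂ leafₑ) (subst (DotBelow g r) c≡e (π c , ≤-reflexive 1+r≡πc , proj₁ (leaf c))))
      ... | tri> _ _ e<c = ⊥-elim (proj₂ (proj₂ leafₑ) (c , e<c , dot))
      left : ParentLeft e
      left with parentAbove⊎parentLeft e
      ... | inj₂ left = left
      ... | inj₁ (r′ , 1+r′≡πe , dot′) = ⊥-elim (¬above×left (proj₁ (leaf e))
              (r′ , ≤-reflexive 1+r′≡πe , dot′) (c , c<e , subst (λ r″ → Dot g r″ c) (sym πe≡r) dot))

  beforePartner : ∀ {c} → ParentAbove c → Σ (Fin n) ParentAbove
  beforePartner {c} above = Partner.before P , parentLeft⇒parentAbove (Partner.left P)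
    where
      P : Partner c
      P = partner above

  beforePartner-inflationary : ∀ {c} (above : ParentAbove c) → c Fin.≤ proj₁ (beforePartner above)
  beforePartner-inflationary {c} above =
    s≤s⁻¹ (subst (suc (toℕ c) ≤_) (sym (Partner.1+before≡column P)) (Partner.right P))
    where
      P : Partner c
      P = partner above

  beforePartner-injective : ∀ {c d} (x : ParentAbove c) (y : ParentAbove d) →
    proj₁ (beforePartner x) ≡ proj₁ (beforePartner y) → c ≡ d
  beforePartner-injective {c} {d} x y c′≡d′ = ⟨$⟩ʳ-injective σ (toℕ-injective
    (trans (sym (Partner.rowAbove P)) (trans (cong (suc ∘ toℕ ∘ π) e≡f) (Partner.rowAbove Q))))
    where
      P : Partner c
      P = partner x
      Q : Partner d
      Q = partner y
      e≡f : Partner.column P ≡ Partner.column Q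
      e≡f = toℕ-injective (trans (sym (Partner.1+before≡column P))
                           (trans (cong (suc ∘ toℕ) c′≡d′) (Partner.1+before≡column Q)))

  partner-nextColumn : ∀ {c} (above : ParentAbove c) → toℕ (Partner.column (partner above)) ≡ suc (toℕ c)
  partner-nextColumn above = trans (sym (Partner.1+before≡column (partner above))) (cong (suc ∘ toℕ)
    (inflationary-injection-fixes beforePartner beforePartner-inflationary beforePartner-injective above))

  evenColumn-parentAbove : ∀ k (c : Fin n) → toℕ c ≡ k + k → ParentAbove c
  evenColumn-parentAbove zero c c≡0 with parentAbove⊎parentLeft c
  ... | inj₁ above = above
  ... | inj₂ (_ , 1+c′≡c , _) = contradiction (trans 1+c′≡c c≡0) λ ()
  evenColumn-parentAbove (suc k) c c≡2k+2 with parentAbove⊎parentLeft c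
  ... | inj₁ above = above
  ... | inj₂ left@(c′ , 1+c′≡c , _) =
    ⊥-elim (¬parentAbove×parentLeft (parentLeft⇒parentAbove left) (subst ParentLeft e≡c′ (Partner.left P)))
    where
      c≡2+k+k : toℕ c ≡ suc (suc (k + k))
      c≡2+k+k = trans c≡2k+2 (cong suc (+-suc k k))
      k+k<n : k + k < n
      k+k<n = <-trans (<-trans (n<1+n _) (n<1+n _)) (subst (_< n) c≡2+k+k (toℕ<n c))
      above : ParentAbove (fromℕ< k+k<n)
      above = evenColumn-parentAbove k (fromℕ< k+k<n) (toℕ-fromℕ< k+k<n)
      P : Partner (fromℕ< k+k<n)
      P = partner above
      e≡c′ : Partner.column P ≡ c′
      e≡c′ = toℕ-injective (trans (partner-nextColumn above)
        (trans (cong suc (toℕ-fromℕ< k+k<n)) (sym (suc-injective (trans 1+c′≡c c≡2+k+k)))))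

  π-paired : ∀ k → k + k < n → onℕ π (k + k) ≡ suc (onℕ π (suc (k + k)))
  π-paired k k+k<n = begin
      onℕ π (k + k)              ≡˘⟨ cong (onℕ π) (toℕ-fromℕ< k+k<n) ⟩
      onℕ π (toℕ b)              ≡⟨ onℕ-toℕ π b ⟩
      toℕ (π b)                  ≡˘⟨ Partner.rowAbove P ⟩
      suc (toℕ (π e))            ≡˘⟨ cong suc (onℕ-toℕ π e) ⟩
      suc (onℕ π (toℕ e))        ≡⟨ cong (suc ∘ onℕ π) e≡1+k+k ⟩
      suc (onℕ π (suc (k + k)))  ∎
    where
      b : Fin n
      b = fromℕ< k+k<n
      above : ParentAbove b
      above = evenColumn-parentAbove k b (toℕ-fromℕ< k+k<n)
      P : Partner b
      P = partner above
      e : Fin n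
      e = Partner.column P
      e≡1+k+k : toℕ e ≡ suc (k + k)
      e≡1+k+k = trans (partner-nextColumn above) (cong suc (toℕ-fromℕ< k+k<n))

proposition3 : (p : ℕ) → 1 ≤ p →
    (g : Grid (2 * p)) → IsCNAT g → AllLeavesShort g →
    (σ : Permutation′ (2 * p)) → IsLeafPermutation g σ →
    sgn σ ≡ neg1^ p
proposition3 p _ g cnat short σ leaves =
  sgn-paired p (cong (p +_) (+-identityʳ p)) σ (ShortLeaves.π-paired g (IsCNAT.nat cnat) short σ leaves)
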